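{- Let $k \ge 4$, let $w \in \mathfrak{S}_n$, and let $\bm{j}$ be a reduced decomposition of $w_0^{(k)} = k(k-1)\cdots 21 \in \mathfrak{S}_k$. If $\bm{j}^{M_1}\bm{j}^{M_2}\cdots\bm{j}^{M_r}$ (concatenation) is a reduced decomposition of $w$ for some nonnegative integers $M_1,\dots,M_r$, then $M_1,\dots,M_r$ are pairwise distinct.
   Context: $\mathfrak{S}_n$ is generated by $s_i=(i\ i+1)$, $i\in[n-1]$. A reduced decomposition of $w$ is a string $i_1\cdots i_\ell$ with $w=s_{i_1}\cdots s_{i_\ell}$ and $\ell$ minimal. For a string $\bm{i}=i_1\cdots i_\ell$ and a nonnegative integer $M$, $\bm{i}^M = (i_1+M)\cdots(i_\ell+M)$ denotes its shift by $M$. -}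

module Defs where

open import Data.Nat using (ℕ; zero; suc; _+_; _∸_; _≤_; _≡ᵇ_)
open import Data.Bool using (if_then_else_)
open import Data.Fin using (Fin; toℕ; opposite)
open import Data.Fin.Permutation using (Permutation′; _⟨$⟩ʳ_)
open import Data.List using (List; []; _∷_; length; map; concatMap)
open import Data.List.Relation.Unary.All using (All)
open import Data.Product using (_×_)
open import Relation.Binary.PropositionalEquality using (_≡_)

-- Words (strings) over the letters 1,2,3,... ; letter i stands for s_i = (i i+1).
Word : Set
Word = List ℕ

swap : ℕ → ℕ → ℕ
swap i x = if x ≡ᵇ i then suc i else (if x ≡ᵇ suc i then i else x)

evalWord : Word → ℕ → ℕ
evalWord []       x = x
evalWord (i ∷ is) x = swap i (evalWord is x)

ValidLetter : ℕ → ℕ → Set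
ValidLetter n i = (1 ≤ i) × (i ≤ n ∸ 1)

-- The word is a decomposition (in generators of S_n) of the permutation g of [n]
-- (Fin n index j stands for the element j+1 of [n]).
Represents : (n : ℕ) → (Fin n → Fin n) → Word → Set
Represents n g ws =
  All (ValidLetter n) ws × (∀ (j : Fin n) → evalWord ws (suc (toℕ j)) ≡ suc (toℕ (g j)))

IsReduced : (n : ℕ) → (Fin n → Fin n) → Word → Set
IsReduced n g ws =
  Represents n g ws × (∀ (vs : Word) → Represents n g vs → length ws ≤ length vs)

perm : {n : ℕ} → Permutation′ n → Fin n → Fin n
perm w j = w ⟨$⟩ʳ j

w0 : (k : ℕ) → Fin k → Fin k
w0 k = opposite

shift : ℕ → Word → Word
shift M ws = map (_+ M) ws

shiftedConcat : Word → List ℕ → Word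
shiftedConcat js Ms = concatMap (λ M → shift M js) Ms

-- Shifting a reduced word of w0 by M gives a word acting as the reversal of the window
-- {M+1, …, M+k}, and the words of two blocks whose windows share two adjacent points p, p+1
-- each invert this pair.  If every block in between leaves p and p+1 alone, the pair is
-- inverted twice, so the two responsible letters can be deleted and the word is not reduced.
-- Between two blocks with equal shifts, look at the innermost pair of blocks whose shifts
-- differ by at most k − 2; all blocks strictly between them are then far from both, and for
-- k ≥ 4 a common pair p, p+1 avoided by all of them exists.
module Submission where

open import Defs
open import Data.Nat using (ℕ; zero; suc; _+_; _∸_; _≤_; _<_; _⊔_; _≡ᵇ_; _≟_; _≤?_; z≤n; s≤s)
open import Data.Nat.Properties
open import Data.Nat.Induction using (<-wellFounded)
open import Data.Nat.Tactic.RingSolver using (solve-∀)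
open import Data.Fin using (toℕ; fromℕ<; opposite)
open import Data.Fin.Properties using (toℕ-fromℕ<; opposite-prop)
open import Data.Fin.Permutation using (Permutation′)
open import Data.List using (List; []; _∷_; _++_; length; map; concat)
open import Data.List.Properties using (++-assoc; length-++-sucʳ; length-++-≤ˡ; length-++-≤ʳ; map-++; concat-++)
open import Data.List.Membership.Propositional using (_∈_; find)
open import Data.List.Membership.Propositional.Properties using (∈-∃++)
open import Data.List.Relation.Unary.All as All using (All; []; _∷_)
open import Data.List.Relation.Unary.All.Properties using (++⁺; ++⁻; ¬Any⇒All¬)
open import Data.List.Relation.Unary.Any using (any?)
open import Data.List.Relation.Unary.AllPairs using ([]; _∷_)
open import Data.List.Relation.Unary.Unique.Propositional using (Unique)
open import Data.Product as Product using (_×_; _,_; proj₁; proj₂; ∃-syntax)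
open import Data.Sum as Sum using (_⊎_; inj₁; inj₂)
open import Data.Empty using (⊥-elim)
open import Data.Unit using (tt)
open import Data.Bool using (true; false; T)
open import Function using (_∘_)
open import Induction.WellFounded using (Acc; acc)
open import Relation.Nullary using (¬_; Dec; yes; no)
open import Relation.Nullary.Decidable using (_×-dec_; _⊎-dec_)
open import Relation.Binary.Definitions using (tri<; tri≈; tri>)
open import Relation.Binary.PropositionalEquality

≡ᵇ-refl : ∀ n → (n ≡ᵇ n) ≡ true
≡ᵇ-refl zero    = refl
≡ᵇ-refl (suc n) = ≡ᵇ-refl n

≢⇒≡ᵇ-false : ∀ {m n} → m ≢ n → (m ≡ᵇ n) ≡ false
≢⇒≡ᵇ-false {m} {n} m≢n with m ≡ᵇ n in eq
... | false = refl
... | true  = ⊥-elim (m≢n (≡ᵇ⇒≡ m n (subst T (sym eq) tt)))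

swap-here : ∀ i → swap i i ≡ suc i
swap-here i rewrite ≡ᵇ-refl i = refl

swap-next : ∀ i → swap i (suc i) ≡ i
swap-next i rewrite ≢⇒≡ᵇ-false (1+n≢n {i}) | ≡ᵇ-refl i = refl

swap-other : ∀ {i x} → x ≢ i → x ≢ suc i → swap i x ≡ x
swap-other x≢i x≢1+i rewrite ≢⇒≡ᵇ-false x≢i | ≢⇒≡ᵇ-false x≢1+i = refl

data SwapCase (i x : ℕ) : Set where
  at-here  : x ≡ i → SwapCase i x
  at-next  : x ≡ suc i → SwapCase i x
  at-other : x ≢ i → x ≢ suc i → SwapCase i x

swapCase : ∀ i x → SwapCase i x
swapCase i x with x ≟ i | x ≟ suc i
... | yes x≡i | _        = at-here x≡i
... | no _    | yes x≡1+i = at-next x≡1+i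
... | no x≢i  | no x≢1+i  = at-other x≢i x≢1+i

swap-involutive : ∀ i x → swap i (swap i x) ≡ x
swap-involutive i x with swapCase i x
... | at-here refl = trans (cong (swap i) (swap-here i)) (swap-next i)
... | at-next refl = trans (cong (swap i) (swap-next i)) (swap-here i)
... | at-other x≢i x≢1+i = trans (cong (swap i) (swap-other x≢i x≢1+i)) (swap-other x≢i x≢1+i)

swap-injective : ∀ i {x y} → swap i x ≡ swap i y → x ≡ y
swap-injective i {x} {y} eq =
  trans (sym (swap-involutive i x)) (trans (cong (swap i) eq) (swap-involutive i y))

swap-fixes : ∀ {i x} → x < i ⊎ suc i < x → swap i x ≡ x
swap-fixes (inj₁ x<i)   = swap-other (<⇒≢ x<i) (<⇒≢ (m<n⇒m<1+n x<i))
swap-fixes (inj₂ 1+i<x) = swap-other (>⇒≢ (<-trans (n<1+n _) 1+i<x)) (>⇒≢ 1+i<x)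

swap-inverts-only-adjacent : ∀ i {a b} → a < b → swap i b < swap i a → a ≡ i × b ≡ suc i
swap-inverts-only-adjacent i {a} {b} a<b inv with swapCase i a | swapCase i b
... | at-here refl | at-here refl = ⊥-elim (<-irrefl refl a<b)
... | at-here refl | at-next refl = refl , refl
... | at-here refl | at-other b≢i b≢1+i
      rewrite swap-here i | swap-other b≢i b≢1+i = ⊥-elim (<⇒≱ a<b (≤-pred inv))
... | at-next refl | at-here refl = ⊥-elim (<-asym a<b (n<1+n i))
... | at-next refl | at-next refl = ⊥-elim (<-irrefl refl a<b)
... | at-next refl | at-other b≢i b≢1+i
      rewrite swap-next i | swap-other b≢i b≢1+i = ⊥-elim (<-asym inv (<-trans (n<1+n i) a<b))
... | at-other a≢i a≢1+i | at-here refl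
      rewrite swap-here i | swap-other a≢i a≢1+i = ⊥-elim (<-asym inv (<-trans a<b (n<1+n i)))
... | at-other a≢i a≢1+i | at-next refl
      rewrite swap-next i | swap-other a≢i a≢1+i = ⊥-elim (<⇒≱ inv (≤-pred a<b))
... | at-other a≢i a≢1+i | at-other b≢i b≢1+i
      rewrite swap-other a≢i a≢1+i | swap-other b≢i b≢1+i = ⊥-elim (<-asym a<b inv)

-- Deleting s_i and s_{i'} from  ⋯ s_i F s_{i'} ⋯  does not change the product when F maps
-- the pair (i', i'+1) onto (i, i+1).
swap-conjugate : ∀ (F : ℕ → ℕ) → (∀ {x y} → F x ≡ F y → x ≡ y) → ∀ {i i'} →
  F i' ≡ i → F (suc i') ≡ suc i → ∀ z → swap i (F (swap i' z)) ≡ F z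
swap-conjugate F F-inj {i} {i'} Fi' Fsi' z with swapCase i' z
... | at-here refl = begin
  swap i (F (swap i' i'))  ≡⟨ cong (swap i ∘ F) (swap-here i') ⟩
  swap i (F (suc i'))      ≡⟨ cong (swap i) Fsi' ⟩
  swap i (suc i)           ≡⟨ swap-next i ⟩
  i                        ≡⟨ Fi' ⟨
  F i'                     ∎
  where open ≡-Reasoning
... | at-next refl = begin
  swap i (F (swap i' (suc i')))  ≡⟨ cong (swap i ∘ F) (swap-next i') ⟩
  swap i (F i')                  ≡⟨ cong (swap i) Fi' ⟩
  swap i i                       ≡⟨ swap-here i ⟩
  suc i                          ≡⟨ Fsi' ⟨
  F (suc i')                     ∎
  where open ≡-Reasoning
... | at-other z≢i' z≢1+i' = trans (cong (swap i ∘ F) (swap-other z≢i' z≢1+i'))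
  (swap-other (z≢i' ∘ F-inj ∘ (λ e → trans e (sym Fi'))) (z≢1+i' ∘ F-inj ∘ (λ e → trans e (sym Fsi'))))

evalWord-++ : ∀ us vs x → evalWord (us ++ vs) x ≡ evalWord us (evalWord vs x)
evalWord-++ []       vs x = refl
evalWord-++ (i ∷ us) vs x = cong (swap i) (evalWord-++ us vs x)

evalWord-injective : ∀ ws {x y} → evalWord ws x ≡ evalWord ws y → x ≡ y
evalWord-injective []       eq = eq
evalWord-injective (i ∷ ws) eq = evalWord-injective ws (swap-injective i eq)

split-at-inversion : ∀ ws {x y} → x < y → evalWord ws y < evalWord ws x →
  ∃[ U ] ∃[ i ] ∃[ V ] ws ≡ U ++ i ∷ V × evalWord V x ≡ i × evalWord V y ≡ suc i
split-at-inversion []       x<y inv = ⊥-elim (<-asym x<y inv)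
split-at-inversion (i ∷ ws) {x} {y} x<y inv with <-cmp (evalWord ws y) (evalWord ws x)
... | tri< ws-inv _ _ =
  let U , i' , V , ws≡ , Vx , Vy = split-at-inversion ws x<y ws-inv
  in i ∷ U , i' , V , cong (i ∷_) ws≡ , Vx , Vy
... | tri≈ _ eq _ = ⊥-elim (<-irrefl (evalWord-injective ws (sym eq)) x<y)
... | tri> _ _ ws-ord =
  let Vx , Vy = swap-inverts-only-adjacent i ws-ord inv in [] , i , ws , refl , Vx , Vy

prefix-at-inversion : ∀ {ws U i V x y} → ws ≡ U ++ i ∷ V → evalWord V x ≡ i → evalWord V y ≡ suc i →
  evalWord U i ≡ evalWord ws y × evalWord U (suc i) ≡ evalWord ws x
prefix-at-inversion {U = U} {i} {V} {x} {y} refl Vx Vy =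
  sym (trans (evalWord-++ U (i ∷ V) y) (cong (evalWord U) (trans (cong (swap i) Vy) (swap-next i)))) ,
  sym (trans (evalWord-++ U (i ∷ V) x) (cong (evalWord U) (trans (cong (swap i) Vx) (swap-here i))))

evalWord-delete-pair : ∀ U i V i' W → evalWord V i' ≡ i → evalWord V (suc i') ≡ suc i →
  ∀ x → evalWord (U ++ i ∷ V ++ i' ∷ W) x ≡ evalWord (U ++ V ++ W) x
evalWord-delete-pair U i V i' W Vi' Vsi' x = begin
  evalWord (U ++ i ∷ V ++ i' ∷ W) x                  ≡⟨ evalWord-++ U _ x ⟩
  evalWord U (swap i (evalWord (V ++ i' ∷ W) x))       ≡⟨ cong (evalWord U ∘ swap i) (evalWord-++ V _ x) ⟩
  evalWord U (swap i (evalWord V (swap i' (evalWord W x))))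
    ≡⟨ cong (evalWord U) (swap-conjugate (evalWord V) (evalWord-injective V) Vi' Vsi' _) ⟩
  evalWord U (evalWord V (evalWord W x))             ≡⟨ cong (evalWord U) (evalWord-++ V W x) ⟨
  evalWord U (evalWord (V ++ W) x)                   ≡⟨ evalWord-++ U (V ++ W) x ⟨
  evalWord (U ++ V ++ W) x                           ∎
  where open ≡-Reasoning

length-delete-pair : ∀ {X : Set} (U : List X) i V i' W →
  length (U ++ i ∷ V ++ i' ∷ W) ≡ suc (suc (length (U ++ V ++ W)))
length-delete-pair U i V i' W = begin
  length (U ++ i ∷ V ++ i' ∷ W)            ≡⟨ length-++-sucʳ U i _ ⟩
  suc (length (U ++ V ++ i' ∷ W))          ≡⟨ cong (suc ∘ length) (++-assoc U V (i' ∷ W)) ⟨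
  suc (length ((U ++ V) ++ i' ∷ W))        ≡⟨ cong suc (length-++-sucʳ (U ++ V) i' W) ⟩
  suc (suc (length ((U ++ V) ++ W)))       ≡⟨ cong (suc ∘ suc ∘ length) (++-assoc U V W) ⟩
  suc (suc (length (U ++ V ++ W)))         ∎
  where open ≡-Reasoning

All-delete-pair : ∀ {X : Set} {P : X → Set} U i V i' W →
  All P (U ++ i ∷ V ++ i' ∷ W) → All P (U ++ V ++ W)
All-delete-pair U i V i' W all with ++⁻ U all
... | all-U , _ ∷ rest with ++⁻ V rest
... | all-V , _ ∷ all-W = ++⁺ all-U (++⁺ all-V all-W)

cancelling-pair-not-reduced : ∀ {n g} U i V i' W → evalWord V i' ≡ i → evalWord V (suc i') ≡ suc i →
  ¬ IsReduced n g (U ++ i ∷ V ++ i' ∷ W)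
cancelling-pair-not-reduced {n} {g} U i V i' W Vi' Vsi' ((valid , represents) , minimal) =
  1+n≰n (≤-trans (n≤1+n _) (subst (_≤ length (U ++ V ++ W)) (length-delete-pair U i V i' W) (minimal _ shorter)))
  where
  shorter : Represents n g (U ++ V ++ W)
  shorter = All-delete-pair U i V i' W valid ,
            λ f → trans (sym (evalWord-delete-pair U i V i' W Vi' Vsi' _)) (represents f)

++-regroup-pair : ∀ {X : Set} (P U : List X) i V Q U' i' V' S →
  P ++ (U ++ i ∷ V) ++ Q ++ (U' ++ i' ∷ V') ++ S ≡ (P ++ U) ++ i ∷ (V ++ Q ++ U') ++ i' ∷ V' ++ S
++-regroup-pair {X} P U i V Q U' i' V' S = begin
  P ++ (U ++ i ∷ V) ++ Q ++ (U' ++ i' ∷ V') ++ S  ≡⟨ cong (λ r → P ++ (U ++ i ∷ V) ++ Q ++ r) (++-assoc U' (i' ∷ V') S) ⟩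
  P ++ (U ++ i ∷ V) ++ Q ++ U' ++ rest               ≡⟨ cong (P ++_) (++-assoc U (i ∷ V) (Q ++ U' ++ rest)) ⟩
  P ++ U ++ i ∷ V ++ Q ++ U' ++ rest                 ≡⟨ ++-assoc P U _ ⟨
  (P ++ U) ++ i ∷ V ++ Q ++ U' ++ rest               ≡⟨ cong (λ r → (P ++ U) ++ i ∷ V ++ r) (++-assoc Q U' rest) ⟨
  (P ++ U) ++ i ∷ V ++ (Q ++ U') ++ rest             ≡⟨ cong (λ r → (P ++ U) ++ i ∷ r) (++-assoc V (Q ++ U') rest) ⟨
  (P ++ U) ++ i ∷ (V ++ Q ++ U') ++ rest             ∎
  where
  open ≡-Reasoning
  rest : List X
  rest = i' ∷ V' ++ S

swap-shift : ∀ l y M → swap (l + M) (y + M) ≡ swap l y + M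
swap-shift l y M with swapCase l y
... | at-here refl = trans (swap-here (l + M)) (cong (_+ M) (sym (swap-here l)))
... | at-next refl = trans (swap-next (l + M)) (cong (_+ M) (sym (swap-next l)))
... | at-other y≢l y≢1+l = trans
  (swap-other (y≢l ∘ +-cancelʳ-≡ M y l) (y≢1+l ∘ +-cancelʳ-≡ M y (suc l)))
  (cong (_+ M) (sym (swap-other y≢l y≢1+l)))

evalWord-shift : ∀ M ws y → evalWord (shift M ws) (y + M) ≡ evalWord ws y + M
evalWord-shift M []       y = refl
evalWord-shift M (l ∷ ws) y = trans (cong (swap (l + M)) (evalWord-shift M ws y)) (swap-shift l (evalWord ws y) M)

shiftedConcat-++ : ∀ j xs ys → shiftedConcat j (xs ++ ys) ≡ shiftedConcat j xs ++ shiftedConcat j ys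
shiftedConcat-++ j xs ys = trans (cong concat (map-++ (λ M → shift M j) xs ys)) (sym (concat-++ (map (λ M → shift M j) xs) (map (λ M → shift M j) ys)))

-- x lies outside the window {N+1, …, N+k} moved by the block  shift N ws  (ws a word in S_k).
Outside : ℕ → ℕ → ℕ → Set
Outside k N x = x ≤ N ⊎ k + N < x

ValidLetter⇒< : ∀ {k l} → ValidLetter k l → l < k
ValidLetter⇒< {zero}  (1≤l , l≤0) = ⊥-elim (<⇒≱ 1≤l l≤0)
ValidLetter⇒< {suc k} (_ , l≤k)   = s≤s l≤k

shift-fixes-outside : ∀ {k N x} ws → All (ValidLetter k) ws → Outside k N x → evalWord (shift N ws) x ≡ x
shift-fixes-outside [] [] _ = refl
shift-fixes-outside {k} {N} {x} (l ∷ ws) (valid ∷ valids) outside =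
  trans (cong (swap (l + N)) (shift-fixes-outside ws valids outside)) (swap-fixes (letter-misses outside))
  where
  letter-misses : Outside k N x → x < l + N ⊎ suc (l + N) < x
  letter-misses (inj₁ x≤N)   = inj₁ (≤-<-trans x≤N (+-monoˡ-≤ N (proj₁ valid)))
  letter-misses (inj₂ k+N<x) = inj₂ (≤-<-trans (+-monoˡ-≤ N (ValidLetter⇒< valid)) k+N<x)

shiftedConcat-fixes-outside : ∀ {k x} j Ns → All (ValidLetter k) j → All (λ N → Outside k N x) Ns →
  evalWord (shiftedConcat j Ns) x ≡ x
shiftedConcat-fixes-outside j []       _     []                  = refl
shiftedConcat-fixes-outside j (N ∷ Ns) valid (outside ∷ outsides) = trans
  (evalWord-++ (shift N j) (shiftedConcat j Ns) _)
  (trans (cong (evalWord (shift N j)) (shiftedConcat-fixes-outside j Ns valid outsides))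
         (shift-fixes-outside j valid outside))

w0-reverses : ∀ {k j} → Represents k (w0 k) j → ∀ s t → suc (s + t) ≡ k → evalWord j (suc s) ≡ suc t
w0-reverses {j = j} (_ , represents) s t refl = begin
  evalWord j (suc s)                         ≡⟨ cong (evalWord j ∘ suc) (toℕ-fromℕ< s<k) ⟨
  evalWord j (suc (toℕ (fromℕ< s<k)))        ≡⟨ represents (fromℕ< s<k) ⟩
  suc (toℕ (opposite (fromℕ< s<k)))          ≡⟨ cong suc (opposite-prop (fromℕ< s<k)) ⟩
  suc (suc (s + t) ∸ suc (toℕ (fromℕ< s<k))) ≡⟨ cong (λ u → suc (suc (s + t) ∸ suc u)) (toℕ-fromℕ< s<k) ⟩
  suc (s + t ∸ s)                            ≡⟨ cong suc (m+n∸m≡n s t) ⟩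
  suc t                                      ∎
  where
  open ≡-Reasoning
  s<k : s < suc (s + t)
  s<k = s≤s (m≤m+n s t)

-- p and p+1 both lie in the window {M+1, …, M+k}.
Window : ℕ → ℕ → ℕ → Set
Window k M p = M < p × p < k + M

Window⇒split : ∀ {k M p} → Window k M p → ∃[ s ] ∃[ t ] p ≡ suc s + M × suc (suc (s + t)) ≡ k
Window⇒split {k} {M} {p} (M<p , p<k+M) with m≤n⇒∃[o]m+o≡n M<p | m≤n⇒∃[o]m+o≡n p<k+M
... | s , refl | t , eq = s , t , cong suc (+-comm M s) ,
  +-cancelʳ-≡ M _ _ (trans (regroup M s t) eq)
  where
  regroup : ∀ M s t → suc (suc (s + t)) + M ≡ suc (suc (M + s)) + t
  regroup = solve-∀

-- The windows of blocks shifted by A and by C share at least two points: ∣A − C∣ ≤ k − 2.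
Close : ℕ → ℕ → ℕ → Set
Close k A C = 2 + C ≤ k + A × 2 + A ≤ k + C

Far : ℕ → ℕ → ℕ → Set
Far k A B = k + B ≤ suc A ⊎ k + A ≤ suc B

close? : ∀ k A C → Dec (Close k A C)
close? k A C = (2 + C ≤? k + A) ×-dec (2 + A ≤? k + C)

¬Close⇒Far : ∀ {k A B} → ¬ Close k A B → Far k A B
¬Close⇒Far {k} {A} {B} ¬close with 2 + B ≤? k + A
... | no  B-far = inj₂ (≤-pred (≰⇒> B-far))
... | yes B-near = inj₁ (≤-pred (≰⇒> (λ A-near → ¬close (B-near , A-near))))

Close-refl : ∀ {k} → 2 ≤ k → ∀ A → Close k A A
Close-refl 2≤k A = +-monoˡ-≤ A 2≤k , +-monoˡ-≤ A 2≤k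

Close-sym : ∀ {k A C} → Close k A C → Close k C A
Close-sym = Product.swap

Far-sym : ∀ {k A B} → Far k A B → Far k B A
Far-sym = Sum.swap

far-from-both : ∀ {k A C N} → 2 ≤ k → Close k A C → Far k A N → Far k N C → k + C ≤ suc N ⊎ k + N ≤ suc A
far-from-both _ _ (inj₁ N-below-A) _                = inj₂ N-below-A
far-from-both _ _ (inj₂ _)         (inj₁ N-above-C) = inj₁ N-above-C
far-from-both {N = N} (s≤s (s≤s _)) (C-near , _) (inj₂ N-above-A) (inj₂ N-below-C) =
  ⊥-elim (<-asym (≤-pred (≤-trans C-near N-above-A)) (≤-trans (s≤s (m≤n+m N _)) (≤-pred N-below-C)))

CommonWindow : ℕ → ℕ → ℕ → Set
CommonWindow k A C = ∃[ p ] Window k A p × Window k C p ×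
  (∀ {N} → Far k A N → Far k N C → Outside k N p × Outside k N (suc p))

-- p = max(C, A + 1) + 1; for A = C this is A + 2, which is where k ≥ 4 is needed.
common-window-≤ : ∀ {k A C} → 4 ≤ k → A ≤ C → Close k A C → CommonWindow k A C
common-window-≤ {A = A} {C} (s≤s (s≤s (s≤s (s≤s {n = K} _)))) A≤C close =
  suc (C ⊔ suc A) ,
  (s≤s (≤-trans (n≤1+n A) (m≤n⊔m C (suc A))) , ⊔-lub (proj₁ close) (s≤s (s≤s (s≤s (m≤n+m A (suc K)))))) ,
  (s≤s (m≤m⊔n C (suc A)) , s≤s (s≤s (≤-trans max≤1+C (s≤s (m≤n+m C (suc K)))))) ,
  clear
  where
  max≤1+C : C ⊔ suc A ≤ suc C
  max≤1+C = ⊔-lub (n≤1+n C) (s≤s A≤C)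

  clear : ∀ {N} → Far _ A N → Far _ N C → Outside _ N (suc (C ⊔ suc A)) × Outside _ N (suc (suc (C ⊔ suc A)))
  clear far-A far-C with far-from-both (s≤s (s≤s z≤n)) close far-A far-C
  ... | inj₁ N-above-C =
    let 1+p≤N = ≤-trans (s≤s (s≤s max≤1+C)) (≤-trans (s≤s (s≤s (s≤s (m≤n+m C K)))) (≤-pred N-above-C))
    in inj₁ (≤-trans (n≤1+n _) 1+p≤N) , inj₁ 1+p≤N
  ... | inj₂ N-below-A =
    let N<p = s≤s (≤-trans N-below-A (m≤n⊔m C (suc A)))
    in inj₂ N<p , inj₂ (m<n⇒m<1+n N<p)

common-window : ∀ {k A C} → 4 ≤ k → Close k A C → CommonWindow k A C
common-window {A = A} {C} 4≤k close with ≤-total A C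
... | inj₁ A≤C = common-window-≤ 4≤k A≤C close
... | inj₂ C≤A =
  let p , window-C , window-A , clear = common-window-≤ 4≤k C≤A (Close-sym close)
  in p , window-A , window-C , λ far-A far-C → clear (Far-sym far-C) (Far-sym far-A)

module _ {k : ℕ} {j : Word} (j-rev : Represents k (w0 k) j) where

  block-reverses-adjacent : ∀ M s t → suc (suc (s + t)) ≡ k →
    evalWord (shift M j) (suc s + M) ≡ suc (suc t) + M × evalWord (shift M j) (suc (suc s) + M) ≡ suc t + M
  block-reverses-adjacent M s t eq =
    trans (evalWord-shift M j (suc s)) (cong (_+ M) (w0-reverses j-rev s (suc t) (trans (cong suc (+-suc s t)) eq))) ,
    trans (evalWord-shift M j (suc (suc s))) (cong (_+ M) (w0-reverses j-rev (suc s) t eq))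

  block-inverts-window : ∀ {M p} → Window k M p → evalWord (shift M j) (suc p) < evalWord (shift M j) p
  block-inverts-window {M} window with Window⇒split window
  ... | s , t , refl , eq =
    let at-p , at-suc-p = block-reverses-adjacent M s t eq
    in subst₂ _<_ (sym at-suc-p) (sym at-p) (n<1+n _)

  block-hits-window : ∀ {M p} → Window k M p →
    ∃[ x ] evalWord (shift M j) x ≡ suc p × evalWord (shift M j) (suc x) ≡ p
  block-hits-window {M} window with Window⇒split window
  ... | s , t , refl , eq = suc t + M , block-reverses-adjacent M t s (trans (cong (suc ∘ suc) (+-comm t s)) eq)

  reversed-twice-not-reduced : ∀ {n g p} L A Mid C R → Window k A p → Window k C p →
    All (λ N → Outside k N p × Outside k N (suc p)) Mid →
    ¬ IsReduced n g (shiftedConcat j (L ++ A ∷ Mid ++ C ∷ R))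
  reversed-twice-not-reduced {n} {g} {p} L A Mid C R window-A window-C outside reduced
    with split-at-inversion (shift A j) (n<1+n p) (block-inverts-window window-A) | block-hits-window window-C
  ... | Ua , i , Va , blockA≡ , Va-p , Va-sp | x , C-x , C-sx
    with split-at-inversion (shift C j) (n<1+n x) (subst₂ _<_ (sym C-sx) (sym C-x) (n<1+n p))
  ... | Uc , i' , Vc , blockC≡ , Vc-x , Vc-sx =
    cancelling-pair-not-reduced (SC L ++ Ua) i (Va ++ SC Mid ++ Uc) i' (Vc ++ SC R)
      (trans (through-middle Uc-i' (All.map proj₁ outside)) Va-p)
      (trans (through-middle Uc-si' (All.map proj₂ outside)) Va-sp)
      (subst (IsReduced n g) regroup reduced)
    where
    open ≡-Reasoning

    SC : List ℕ → Word
    SC = shiftedConcat j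

    Uc-i' : evalWord Uc i' ≡ p
    Uc-i' = trans (proj₁ (prefix-at-inversion blockC≡ Vc-x Vc-sx)) C-sx

    Uc-si' : evalWord Uc (suc i') ≡ suc p
    Uc-si' = trans (proj₂ (prefix-at-inversion blockC≡ Vc-x Vc-sx)) C-x

    through-middle : ∀ {z q} → evalWord Uc z ≡ q → All (λ N → Outside k N q) Mid →
      evalWord (Va ++ SC Mid ++ Uc) z ≡ evalWord Va q
    through-middle {z} {q} Uc-z outside-q = begin
      evalWord (Va ++ SC Mid ++ Uc) z                   ≡⟨ evalWord-++ Va _ z ⟩
      evalWord Va (evalWord (SC Mid ++ Uc) z)           ≡⟨ cong (evalWord Va) (evalWord-++ (SC Mid) Uc z) ⟩
      evalWord Va (evalWord (SC Mid) (evalWord Uc z))   ≡⟨ cong (evalWord Va ∘ evalWord (SC Mid)) Uc-z ⟩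
      evalWord Va (evalWord (SC Mid) q)                 ≡⟨ cong (evalWord Va) (shiftedConcat-fixes-outside j Mid (proj₁ j-rev) outside-q) ⟩
      evalWord Va q                                     ∎

    regroup : SC (L ++ A ∷ Mid ++ C ∷ R) ≡ (SC L ++ Ua) ++ i ∷ (Va ++ SC Mid ++ Uc) ++ i' ∷ Vc ++ SC R
    regroup = begin
      SC (L ++ A ∷ Mid ++ C ∷ R)                             ≡⟨ shiftedConcat-++ j L _ ⟩
      SC L ++ shift A j ++ SC (Mid ++ C ∷ R)                 ≡⟨ cong (λ r → SC L ++ shift A j ++ r) (shiftedConcat-++ j Mid _) ⟩
      SC L ++ shift A j ++ SC Mid ++ shift C j ++ SC R       ≡⟨ cong₂ (λ a c → SC L ++ a ++ SC Mid ++ c ++ SC R) blockA≡ blockC≡ ⟩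
      SC L ++ (Ua ++ i ∷ Va) ++ SC Mid ++ (Uc ++ i' ∷ Vc) ++ SC R  ≡⟨ ++-regroup-pair (SC L) Ua i Va (SC Mid) Uc i' Vc (SC R) ⟩
      (SC L ++ Ua) ++ i ∷ (Va ++ SC Mid ++ Uc) ++ i' ∷ Vc ++ SC R ∎

  close-blocks-not-reduced : ∀ {n g Mid} → 4 ≤ k → Acc _<_ (length Mid) → ∀ L A C R → Close k A C →
    ¬ IsReduced n g (shiftedConcat j (L ++ A ∷ Mid ++ C ∷ R))
  close-blocks-not-reduced {n} {g} {Mid} 4≤k (acc shorter) L A C R close reduced
    with any? (λ N → close? k A N ⊎-dec close? k N C) Mid
  ... | no none =
    let p , window-A , window-C , clear = common-window 4≤k close
        far-from-ends = ¬Any⇒All¬ Mid none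
    in reversed-twice-not-reduced L A Mid C R window-A window-C
         (All.map (λ far → clear (¬Close⇒Far (far ∘ inj₁)) (¬Close⇒Far (far ∘ inj₂))) far-from-ends) reduced
  ... | yes near-an-end with find near-an-end
  ... | N , N∈Mid , near with ∈-∃++ N∈Mid
  ... | ys , zs , refl with near
  ... | inj₁ close-AN =
    close-blocks-not-reduced 4≤k (shorter (subst (length ys <_) (sym (length-++-sucʳ ys N zs)) (s≤s (length-++-≤ˡ ys))))
      L A N (zs ++ C ∷ R) close-AN (subst (IsReduced n g ∘ shiftedConcat j) split-before-N reduced)
    where
    split-before-N : L ++ A ∷ (ys ++ N ∷ zs) ++ C ∷ R ≡ L ++ A ∷ ys ++ N ∷ zs ++ C ∷ R
    split-before-N = cong (λ r → L ++ A ∷ r) (++-assoc ys (N ∷ zs) (C ∷ R))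
  ... | inj₂ close-NC =
    close-blocks-not-reduced 4≤k (shorter (length-++-≤ʳ (N ∷ zs) {ys}))
      (L ++ A ∷ ys) N C R close-NC (subst (IsReduced n g ∘ shiftedConcat j) split-after-N reduced)
    where
    split-after-N : L ++ A ∷ (ys ++ N ∷ zs) ++ C ∷ R ≡ (L ++ A ∷ ys) ++ N ∷ zs ++ C ∷ R
    split-after-N = trans (cong (λ r → L ++ A ∷ r) (++-assoc ys (N ∷ zs) (C ∷ R)))
                          (sym (++-assoc L (A ∷ ys) (N ∷ zs ++ C ∷ R)))

¬repeated⇒Unique : ∀ {X : Set} (xs : List X) → (∀ L x Mid R → xs ≢ L ++ x ∷ Mid ++ x ∷ R) → Unique xs
¬repeated⇒Unique []       _     = []
¬repeated⇒Unique (x ∷ xs) no-rep =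
  All.tabulate distinct ∷ ¬repeated⇒Unique xs (λ L y Mid R → no-rep (x ∷ L) y Mid R ∘ cong (x ∷_))
  where
  distinct : ∀ {y} → y ∈ xs → x ≢ y
  distinct y∈xs refl with ∈-∃++ y∈xs
  ... | Mid , R , xs≡ = no-rep [] x Mid R (cong (x ∷_) xs≡)

proposition6p3 : (k n : ℕ) → 4 ≤ k → (w : Permutation′ n) → (j : Word) → IsReduced k (w0 k) j →
    (Ms : List ℕ) → IsReduced n (perm w) (shiftedConcat j Ms) → Unique Ms
proposition6p3 k n 4≤k w j (j-rev , _) Ms reduced =
  ¬repeated⇒Unique Ms λ L M Mid R Ms≡ →
    close-blocks-not-reduced j-rev 4≤k (<-wellFounded _) L M M R (Close-refl 2≤k M)
      (subst (IsReduced n (perm w) ∘ shiftedConcat j) Ms≡ reduced)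
  where
  2≤k : 2 ≤ k
  2≤k = ≤-trans (s≤s (s≤s z≤n)) 4≤k
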